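{- Let $n\ge 3$ and let $s,t$ be indeterminates. Let $\mathfrak{D}_n^5$ be the set of $\pi\in\mathfrak{D}_n$ such that $\pi''\in\mathfrak{D}_{n-2}$, both $-n$ and $-(n-1)$ appear among $\pi_1,\dots,\pi_n$, and their positions differ by more than $1$. Then $$\sum_{\pi\in\mathfrak{D}_n^5}(-1)^{\mathrm{inv}_D(\pi)}s^{\mathrm{asc}_B(\pi)}t^{\mathrm{des}_B(\pi)}=0.$$
   Context: $\mathfrak{B}_n$ is the group of signed permutations of $\{\pm1,\dots,\pm n\}$, written $\pi=\pi_1\cdots\pi_n$ with $\pi_i=\pi(i)$. $\mathrm{negs}(\pi)=|\{i:\pi_i<0\}|$; $\mathfrak{D}_n=\{\pi\in\mathfrak{B}_n:\mathrm{negs}(\pi)\text{ even}\}$. $\mathrm{inv}_D(\pi)=|\{i<j:\pi_i>\pi_j\}|+|\{i<j:-\pi_i>\pi_j\}|$. With $\pi_0=0$, $\mathrm{des}_B(\pi)=|\{i\in\{0,\dots,n-1\}:\pi_i>\pi_{i+1}\}|$ and $\mathrm{asc}_B(\pi)=n-\mathrm{des}_B(\pi)$. For $\pi\in\mathfrak{B}_n$, $\pi''\in\mathfrak{B}_{n-2}$ is the signed word obtained from $\pi_1\cdots\pi_n$ by deleting the two entries whose absolute values are $n$ and $n-1$. -}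

module Defs where

open import Level using (Level)
open import Data.Bool using (Bool; true; false; _∧_; _∨_; not; if_then_else_; T)
open import Data.Nat as ℕ using (ℕ; zero; suc; _∸_; _≡ᵇ_; _<ᵇ_)
open import Data.Integer as ℤ using (ℤ; +_; -_; ∣_∣)
import Data.Integer.Properties as ℤP
open import Data.List using (List; []; _∷_; _++_; map; concatMap; filter; length; upTo; foldr)
open import Data.Bool.ListAction using (any)
open import Data.Maybe using (Maybe; just; nothing)
open import Relation.Nullary.Decidable using (⌊_⌋)
open import Relation.Nullary using (Dec)
open import Data.Bool.Properties using (T?)
open import Algebra.Bundles using (CommutativeRing)

_<ℤ_ : ℤ → ℤ → Bool
x <ℤ y = ⌊ x ℤ.<? y ⌋

_==ℤ_ : ℤ → ℤ → Bool
x ==ℤ y = ⌊ x ℤ.≟ y ⌋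

letters : ℕ → List ℤ
letters n = map (λ i → + suc i) (upTo n) ++ map (λ i → - (+ suc i)) (upTo n)

words : ℕ → ℕ → List (List ℤ)
words zero    n = [] ∷ []
words (suc k) n = concatMap (λ x → map (x ∷_) (words k n)) (letters n)

distinctAbs : List ℤ → Bool
distinctAbs []       = true
distinctAbs (x ∷ xs) = not (any (λ y → ∣ x ∣ ≡ᵇ ∣ y ∣) xs) ∧ distinctAbs xs

-- 𝔅ₙ: signed permutations π = π₁⋯πₙ, written as words in one-line notation
-- (a word of length n over ±1..±n whose absolute values are 1..n, each once)
B : ℕ → List (List ℤ)
B n = filter (λ w → T? (distinctAbs w)) (words n n)

negs : List ℤ → ℕ
negs []       = 0
negs (x ∷ xs) = (if x <ℤ (+ 0) then 1 else 0) ℕ.+ negs xs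

evenᵇ : ℕ → Bool
evenᵇ zero          = true
evenᵇ (suc zero)    = false
evenᵇ (suc (suc k)) = evenᵇ k

inDᵇ : List ℤ → Bool
inDᵇ π = evenᵇ (negs π)

D : ℕ → List (List ℤ)
D n = filter (λ π → T? (inDᵇ π)) (B n)

count : {A : Set} → (A → Bool) → List A → ℕ
count p []       = 0
count p (x ∷ xs) = (if p x then 1 else 0) ℕ.+ count p xs

invD : List ℤ → ℕ
invD []       = 0
invD (x ∷ xs) = count (λ y → y <ℤ x) xs ℕ.+ count (λ y → y <ℤ (- x)) xs ℕ.+ invD xs

desFrom : ℤ → List ℤ → ℕ
desFrom p []       = 0
desFrom p (x ∷ xs) = (if x <ℤ p then 1 else 0) ℕ.+ desFrom x xs

desB : List ℤ → ℕ
desB π = desFrom (+ 0) π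

ascB : List ℤ → ℕ
ascB π = length π ∸ desB π

dd : ℕ → List ℤ → List ℤ
dd n π = filter (λ x → T? (not ((∣ x ∣ ≡ᵇ n) ∨ (∣ x ∣ ≡ᵇ n ∸ 1)))) π

-- position (1-based) of a value in a word
pos : ℤ → List ℤ → Maybe ℕ
pos v []       = nothing
pos v (x ∷ xs) with x ==ℤ v
... | true  = just 1
... | false with pos v xs
...   | just k  = just (suc k)
...   | nothing = nothing

farApartᵇ : ℕ → ℕ → Bool
farApartᵇ a b = (suc a <ᵇ b) ∨ (suc b <ᵇ a)

cond5 : ℕ → List ℤ → Bool
cond5 n π with pos (- (+ n)) π | pos (- (+ (n ∸ 1))) π
... | just i | just j = inDᵇ (dd n π) ∧ farApartᵇ i j
... | _      | _      = false

D5 : ℕ → List (List ℤ)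
D5 n = filter (λ π → T? (cond5 n π)) (D n)

module _ {c ℓ : Level} (R : CommutativeRing c ℓ) where
  open CommutativeRing R using (Carrier; 1#; 0#; _*_; _+_) renaming (-_ to neg)

  pow : Carrier → ℕ → Carrier
  pow x zero    = 1#
  pow x (suc k) = x * pow x k

  signPow : ℕ → Carrier
  signPow k = pow (neg 1#) k

  genSum : Carrier → Carrier → List (List ℤ) → Carrier
  genSum s t L = foldr (λ π acc → signPow (invD π) * pow s (ascB π) * pow t (desB π) + acc) 0# L

-- Let τ exchange the letters ±(n-1) and ±n of a signed word, keeping signs. A word
-- π ∈ 𝔇ₙ⁵ contains -n and -(n-1) at non-adjacent positions, hence contains neither
-- n nor n-1. The only comparisons τ reverses are -n against -(n-1) and n-1 against n.
-- Therefore τ preserves negs(π), negs(π'') and the positions condition, so it maps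
-- 𝔇ₙ⁵ to itself; it preserves des_B, because the reversed pair is never adjacent and
-- never next to π₀ = 0; and it changes inv_D by exactly one, because only the pair
-- -n, -(n-1) changes order. So τ matches the terms in which -n precedes -(n-1) with
-- the terms in which it follows, with opposite signs, and the sum vanishes.

module Submission where

open import Defs
open import Level using (Level)
open import Algebra.Bundles using (CommutativeRing)
import Algebra.Properties.Ring as RingProperties
open import Data.Bool using (Bool; true; false; _∧_; _∨_; not; if_then_else_; T)
open import Data.Bool.Properties using (T?; ∨-comm; ∧-comm; ∨-conicalˡ; ∨-conicalʳ; if-∧)
open import Data.Bool.ListAction using (any)
open import Data.Empty using (⊥-elim)
open import Data.Integer as ℤ using (ℤ; +_; ∣_∣; -[1+_])
import Data.Integer.Properties as ℤP
open import Data.List using (List; []; _∷_; _++_; _∷ʳ_; map; filter; foldr; concatMap; upTo)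
open import Data.List.Properties using (upTo-∷ʳ; ++-assoc; length-map)
open import Data.List.Membership.Propositional using (_∈_; _∉_)
open import Data.List.Membership.Propositional.Properties using (∈-upTo⁻)
open import Data.List.Relation.Unary.All as All using (All; []; _∷_)
open import Data.List.Relation.Unary.Any using (here; there)
open import Data.List.Relation.Unary.Linked as Linked using (Linked; [-]; _∷_)
open import Data.Maybe as Maybe using (Maybe; just; nothing)
open import Data.Nat as ℕ using (ℕ; zero; suc; _∸_; _≤_; _≡ᵇ_; _<ᵇ_; s≤s)
import Data.Nat.Properties as ℕP
open import Data.Product using (_×_; _,_; ∃₂; proj₁; proj₂)
open import Data.Sum using (_⊎_; inj₁; inj₂)
open import Function using (_∘_; case_of_)
open import Relation.Nullary using (¬_; Dec; does)
open import Relation.Nullary.Decidable using (isYes; isYes≗does; dec-true; dec-false; toWitness)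
open import Relation.Binary.PropositionalEquality
  using (_≡_; _≢_; refl; sym; trans; cong; cong₂; subst; ≢-sym; module ≡-Reasoning)

IsPair : {A : Set} → A → A → A → A → Set
IsPair u v a b = (a ≡ u × b ≡ v) ⊎ (a ≡ v × b ≡ u)

IsPair-sym : {A : Set} {u v a b : A} → IsPair u v a b → IsPair v u a b
IsPair-sym (inj₁ p) = inj₂ p
IsPair-sym (inj₂ p) = inj₁ p

IsPair-flip : {A : Set} {u v a b : A} → IsPair u v a b → IsPair u v b a
IsPair-flip (inj₁ (a≡u , b≡v)) = inj₂ (b≡v , a≡u)
IsPair-flip (inj₂ (a≡v , b≡u)) = inj₁ (b≡u , a≡v)

swapAdj : ℕ → ℕ → ℕ
swapAdj zero    zero          = 1
swapAdj zero    (suc zero)    = 0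
swapAdj zero    (suc (suc i)) = suc (suc i)
swapAdj (suc c) zero          = zero
swapAdj (suc c) (suc i)       = suc (swapAdj c i)

swapAdj-left : ∀ c → swapAdj c c ≡ suc c
swapAdj-left zero    = refl
swapAdj-left (suc c) = cong suc (swapAdj-left c)

swapAdj-right : ∀ c → swapAdj c (suc c) ≡ c
swapAdj-right zero    = refl
swapAdj-right (suc c) = cong suc (swapAdj-right c)

swapAdj-below : ∀ c i → i ℕ.< c → swapAdj c i ≡ i
swapAdj-below (suc c) zero    _         = refl
swapAdj-below (suc c) (suc i) (s≤s i<c) = cong suc (swapAdj-below c i i<c)

swapAdj-≡ᵇ : ∀ c i j → (swapAdj c i ≡ᵇ swapAdj c j) ≡ (i ≡ᵇ j)
swapAdj-≡ᵇ zero    zero          zero          = refl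
swapAdj-≡ᵇ zero    zero          (suc zero)    = refl
swapAdj-≡ᵇ zero    zero          (suc (suc j)) = refl
swapAdj-≡ᵇ zero    (suc zero)    zero          = refl
swapAdj-≡ᵇ zero    (suc zero)    (suc zero)    = refl
swapAdj-≡ᵇ zero    (suc zero)    (suc (suc j)) = refl
swapAdj-≡ᵇ zero    (suc (suc i)) zero          = refl
swapAdj-≡ᵇ zero    (suc (suc i)) (suc zero)    = refl
swapAdj-≡ᵇ zero    (suc (suc i)) (suc (suc j)) = refl
swapAdj-≡ᵇ (suc c) zero          zero          = refl
swapAdj-≡ᵇ (suc c) zero          (suc j)       = refl
swapAdj-≡ᵇ (suc c) (suc i)       zero          = refl
swapAdj-≡ᵇ (suc c) (suc i)       (suc j)       = swapAdj-≡ᵇ c i j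

swapAdj-<ᵇ : ∀ c i j → ¬ IsPair c (suc c) i j → (swapAdj c i <ᵇ swapAdj c j) ≡ (i <ᵇ j)
swapAdj-<ᵇ zero    zero          zero          _ = refl
swapAdj-<ᵇ zero    zero          (suc zero)    p = ⊥-elim (p (inj₁ (refl , refl)))
swapAdj-<ᵇ zero    zero          (suc (suc j)) _ = refl
swapAdj-<ᵇ zero    (suc zero)    zero          p = ⊥-elim (p (inj₂ (refl , refl)))
swapAdj-<ᵇ zero    (suc zero)    (suc zero)    _ = refl
swapAdj-<ᵇ zero    (suc zero)    (suc (suc j)) _ = refl
swapAdj-<ᵇ zero    (suc (suc i)) zero          _ = refl
swapAdj-<ᵇ zero    (suc (suc i)) (suc zero)    _ = refl
swapAdj-<ᵇ zero    (suc (suc i)) (suc (suc j)) _ = refl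
swapAdj-<ᵇ (suc c) zero          zero          _ = refl
swapAdj-<ᵇ (suc c) zero          (suc j)       _ = refl
swapAdj-<ᵇ (suc c) (suc i)       zero          _ = refl
swapAdj-<ᵇ (suc c) (suc i)       (suc j)       p = swapAdj-<ᵇ c i j (p ∘ IsPair-suc)
  where
  IsPair-suc : IsPair c (suc c) i j → IsPair (suc c) (suc (suc c)) (suc i) (suc j)
  IsPair-suc (inj₁ (i≡c , j≡1+c)) = inj₁ (cong suc i≡c , cong suc j≡1+c)
  IsPair-suc (inj₂ (i≡1+c , j≡c)) = inj₂ (cong suc i≡1+c , cong suc j≡c)

filter-map : {A : Set} (p : A → Bool) (f : A → A) → (∀ x → p (f x) ≡ p x) →
  ∀ w → filter (T? ∘ p) (map f w) ≡ map f (filter (T? ∘ p) w)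
filter-map p f p∘f≡p []       = refl
filter-map p f p∘f≡p (x ∷ xs) rewrite p∘f≡p x with p x
... | true  = cong (f x ∷_) (filter-map p f p∘f≡p xs)
... | false = filter-map p f p∘f≡p xs

∧≡true⇒ˡ : ∀ a b → a ∧ b ≡ true → a ≡ true
∧≡true⇒ˡ true _ _ = refl

∧≡true⇒ʳ : ∀ a b → a ∧ b ≡ true → b ≡ true
∧≡true⇒ʳ true _ eq = eq

farApartᵇ-sym : ∀ i j → farApartᵇ i j ≡ farApartᵇ j i
farApartᵇ-sym i j = ∨-comm (suc i <ᵇ j) (suc j <ᵇ i)

farApartᵇ⇒<ᵇ-flip : ∀ i j → farApartᵇ i j ≡ true → (j <ᵇ i) ≡ not (i <ᵇ j)
farApartᵇ⇒<ᵇ-flip zero    (suc j) _   = refl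
farApartᵇ⇒<ᵇ-flip (suc i) zero    _   = refl
farApartᵇ⇒<ᵇ-flip (suc i) (suc j) far = farApartᵇ⇒<ᵇ-flip i j far

farApartᵐ : Maybe ℕ → Maybe ℕ → Bool
farApartᵐ (just i) (just j) = farApartᵇ i j
farApartᵐ _        _        = false

farApartᵐ-sym : ∀ a b → farApartᵐ a b ≡ farApartᵐ b a
farApartᵐ-sym (just i) (just j) = farApartᵇ-sym i j
farApartᵐ-sym (just i) nothing  = refl
farApartᵐ-sym nothing  (just j) = refl
farApartᵐ-sym nothing  nothing  = refl

farApartᵐ⇒just : ∀ a b → farApartᵐ a b ≡ true → ∃₂ λ i j → a ≡ just i × b ≡ just j
farApartᵐ⇒just (just i) (just j) _ = i , j , refl , refl

precedesᵐ : Maybe ℕ → Maybe ℕ → Bool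
precedesᵐ (just i) (just j) = i <ᵇ j
precedesᵐ _        _        = false

precedesᵐ-flip : ∀ a b → farApartᵐ a b ≡ true → precedesᵐ b a ≡ not (precedesᵐ a b)
precedesᵐ-flip (just i) (just j) = farApartᵇ⇒<ᵇ-flip i j

-- Signed words with distinct absolute values

isYes≡isYes : ∀ {a b} {A : Set a} {B : Set b} (a? : Dec A) (b? : Dec B) →
  does a? ≡ does b? → isYes a? ≡ isYes b?
isYes≡isYes a? b? eq = trans (isYes≗does a?) (trans eq (sym (isYes≗does b?)))

module _ {x y : ℤ} where

  ==ℤ⇒≡ : x ==ℤ y ≡ true → x ≡ y
  ==ℤ⇒≡ eq = toWitness (subst T (sym eq) _)

  ≡⇒==ℤ : x ≡ y → x ==ℤ y ≡ true
  ≡⇒==ℤ eq = trans (isYes≗does (x ℤ.≟ y)) (dec-true (x ℤ.≟ y) eq)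

  ≢⇒==ℤ : x ≢ y → x ==ℤ y ≡ false
  ≢⇒==ℤ ne = trans (isYes≗does (x ℤ.≟ y)) (dec-false (x ℤ.≟ y) ne)

  <⇒<ℤ : x ℤ.< y → x <ℤ y ≡ true
  <⇒<ℤ lt = trans (isYes≗does (x ℤ.<? y)) (dec-true (x ℤ.<? y) lt)

  ≮⇒<ℤ : ¬ x ℤ.< y → x <ℤ y ≡ false
  ≮⇒<ℤ nlt = trans (isYes≗does (x ℤ.<? y)) (dec-false (x ℤ.<? y) nlt)

  ==ℤ-false⇒≢ : x ==ℤ y ≡ false → x ≢ y
  ==ℤ-false⇒≢ eq x≡y with () ← trans (sym eq) (≡⇒==ℤ x≡y)

∈∧∉⇒≢ : {A : Set} {y z : A} {xs : List A} → y ∈ xs → z ∉ xs → y ≢ z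
∈∧∉⇒≢ y∈ z∉ refl = z∉ y∈

∉-∷ : {A : Set} {y x : A} {xs : List A} → y ∉ x ∷ xs → y ≢ x × y ∉ xs
∉-∷ y∉ = y∉ ∘ here , y∉ ∘ there

pos-∷ : ∀ v x xs → pos v (x ∷ xs) ≡ (if x ==ℤ v then just 1 else Maybe.map suc (pos v xs))
pos-∷ v x xs with x ==ℤ v
... | true  = refl
... | false with pos v xs
...   | just i  = refl
...   | nothing = refl

pos⇒∈ : ∀ v w {i} → pos v w ≡ just i → v ∈ w
pos⇒∈ v (x ∷ xs) eq rewrite pos-∷ v x xs with x ==ℤ v in x==v | pos v xs in eq′
... | true  | _      = here (sym (==ℤ⇒≡ x==v))
... | false | just j = there (pos⇒∈ v xs eq′)

distinctAbs-∷ : ∀ x xs → distinctAbs (x ∷ xs) ≡ true →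
  All (λ y → ∣ x ∣ ≢ ∣ y ∣) xs × distinctAbs xs ≡ true
distinctAbs-∷ x xs d with any (λ y → ∣ x ∣ ≡ᵇ ∣ y ∣) xs in none
... | false = all-apart xs none , d
  where
  all-apart : ∀ ys → any (λ y → ∣ x ∣ ≡ᵇ ∣ y ∣) ys ≡ false → All (λ y → ∣ x ∣ ≢ ∣ y ∣) ys
  all-apart []       _  = []
  all-apart (y ∷ ys) eq =
    (λ x≡y → subst T (∨-conicalˡ _ _ eq) (ℕP.≡⇒≡ᵇ _ _ x≡y)) ∷ all-apart ys (∨-conicalʳ _ _ eq)

distinctAbs-∈ : ∀ w {x y} → distinctAbs w ≡ true → x ∈ w → y ∈ w → ∣ x ∣ ≡ ∣ y ∣ → x ≡ y
distinctAbs-∈ (z ∷ zs) d (here refl) (here refl) _ = refl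
distinctAbs-∈ (z ∷ zs) d (here refl) (there y∈) ∣x∣≡∣y∣ =
  ⊥-elim (All.lookup (proj₁ (distinctAbs-∷ z zs d)) y∈ ∣x∣≡∣y∣)
distinctAbs-∈ (z ∷ zs) d (there x∈) (here refl) ∣x∣≡∣y∣ =
  ⊥-elim (All.lookup (proj₁ (distinctAbs-∷ z zs d)) x∈ (sym ∣x∣≡∣y∣))
distinctAbs-∈ (z ∷ zs) d (there x∈) (there y∈) ∣x∣≡∣y∣ =
  distinctAbs-∈ zs (proj₂ (distinctAbs-∷ z zs d)) x∈ y∈ ∣x∣≡∣y∣

count-==ℤ-∉ : ∀ xs {v} → v ∉ xs → count (_==ℤ v) xs ≡ 0
count-==ℤ-∉ []       _  = refl
count-==ℤ-∉ (x ∷ xs) v∉ rewrite ≢⇒==ℤ (≢-sym (proj₁ (∉-∷ v∉))) =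
  count-==ℤ-∉ xs (proj₂ (∉-∷ v∉))

count-==ℤ-∈ : ∀ w {v} → distinctAbs w ≡ true → v ∈ w → count (_==ℤ v) w ≡ 1
count-==ℤ-∈ (x ∷ xs) d (here refl) rewrite ≡⇒==ℤ {x} refl =
  cong suc (count-==ℤ-∉ xs λ x∈ → All.lookup (proj₁ (distinctAbs-∷ x xs d)) x∈ refl)
count-==ℤ-∈ (x ∷ xs) {v} d (there v∈)
  rewrite ≢⇒==ℤ {x} {v} (λ { refl → All.lookup (proj₁ (distinctAbs-∷ x xs d)) v∈ refl }) =
  count-==ℤ-∈ xs (proj₂ (distinctAbs-∷ x xs d)) v∈

farApartᵐ-map-suc : ∀ a b → farApartᵐ (Maybe.map suc a) (Maybe.map suc b) ≡ farApartᵐ a b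
farApartᵐ-map-suc (just i) (just j) = refl
farApartᵐ-map-suc (just i) nothing  = refl
farApartᵐ-map-suc nothing  _        = refl

Separated : ℤ → ℤ → List ℤ → Set
Separated u v = Linked (λ a b → ¬ IsPair u v a b)

module _ {u v : ℤ} where

  ¬IsPair-left : ∀ {p x} → p ≢ u → p ≢ v → ¬ IsPair u v p x
  ¬IsPair-left p≢u _ (inj₁ (p≡u , _)) = p≢u p≡u
  ¬IsPair-left _ p≢v (inj₂ (p≡v , _)) = p≢v p≡v

  ¬IsPair-right : ∀ {p x} → x ≢ u → x ≢ v → ¬ IsPair u v p x
  ¬IsPair-right _ x≢v (inj₁ (_ , x≡v)) = x≢v x≡v
  ¬IsPair-right x≢u _ (inj₂ (_ , x≡u)) = x≢u x≡u

  separated-∉ : ∀ p xs → u ∉ p ∷ xs → Separated u v (p ∷ xs)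
  separated-∉ p []       _  = [-]
  separated-∉ p (x ∷ xs) u∉ = noPair ∷ separated-∉ x xs (u∉ ∘ there)
    where
    noPair : ¬ IsPair u v p x
    noPair (inj₁ (p≡u , _)) = u∉ (here (sym p≡u))
    noPair (inj₂ (_ , x≡u)) = u∉ (there (here (sym x≡u)))

  separated-after : ∀ xs → u ≢ v → u ∉ xs →
    farApartᵐ (just 1) (Maybe.map suc (pos v xs)) ≡ true → Separated u v (u ∷ xs)
  separated-after []       _   _  _   = [-]
  separated-after (y ∷ ys) u≢v u∉ far = noPair ∷ separated-∉ y ys u∉
    where
    y≢v : y ≢ v
    y≢v y≡v with () ← subst (λ a → farApartᵐ (just 1) (Maybe.map suc a) ≡ true)
                         (trans (pos-∷ v y ys) (cong (if_then _ else _) (≡⇒==ℤ y≡v))) far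
    noPair : ¬ IsPair u v u y
    noPair (inj₁ (_ , y≡v)) = y≢v y≡v
    noPair (inj₂ (u≡v , _)) = u≢v u≡v

separated : ∀ {u v} p w → distinctAbs w ≡ true → u ≢ v → p ≢ u → p ≢ v →
  farApartᵐ (pos u w) (pos v w) ≡ true → Separated u v (p ∷ w)
separated p []       _ _   _   _   ()
separated {u} {v} p (x ∷ xs) d u≢v p≢u p≢v far
  rewrite pos-∷ u x xs | pos-∷ v x xs with x ==ℤ u in x==u | x ==ℤ v in x==v
... | true  | true  = ⊥-elim (u≢v (trans (sym (==ℤ⇒≡ x==u)) (==ℤ⇒≡ x==v)))
... | true  | false rewrite ==ℤ⇒≡ x==u =
  ¬IsPair-left p≢u p≢v ∷ separated-after xs u≢v u∉xs far
  where
  u∉xs : u ∉ xs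
  u∉xs u∈ = All.lookup (proj₁ (distinctAbs-∷ u xs d)) u∈ refl
... | false | true  rewrite ==ℤ⇒≡ x==v =
  ¬IsPair-left p≢u p≢v ∷ Linked.map (_∘ IsPair-sym)
    (separated-after xs (u≢v ∘ sym) v∉xs (trans (farApartᵐ-sym (just 1) (Maybe.map suc (pos u xs))) far))
  where
  v∉xs : v ∉ xs
  v∉xs v∈ = All.lookup (proj₁ (distinctAbs-∷ v xs d)) v∈ refl
... | false | false =
  ¬IsPair-left p≢u p≢v ∷ separated x xs (proj₂ (distinctAbs-∷ x xs d)) u≢v
    (==ℤ-false⇒≢ x==u) (==ℤ-false⇒≢ x==v) (trans (sym (farApartᵐ-map-suc (pos u xs) (pos v xs))) far)

indicator : Bool → ℕ
indicator b = if b then 1 else 0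

module Counting where
  open import Data.Nat using (_+_; _*_)
  open import Data.Nat.Properties using (+-commutativeSemigroup; +-assoc; *-suc)
  open import Algebra.Properties.CommutativeSemigroup +-commutativeSemigroup using (interchange; x∙yz≈y∙xz)

  desFrom-map : ∀ (f : ℤ → ℤ) p xs → Linked (λ a b → (f b <ℤ f a) ≡ (b <ℤ a)) (p ∷ xs) →
    desFrom (f p) (map f xs) ≡ desFrom p xs
  desFrom-map f p []       _            = refl
  desFrom-map f p (x ∷ xs) (fx<fp ∷ ok) =
    cong₂ (λ b r → indicator b + r) fx<fp (desFrom-map f x xs ok)

  module _ {A : Set} where

    count-map : ∀ (p : ℤ → Bool) (f : A → ℤ) xs → count p (map f xs) ≡ count (p ∘ f) xs
    count-map p f []       = refl
    count-map p f (x ∷ xs) = cong (_+_ (indicator (p (f x)))) (count-map p f xs)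

    count-false : ∀ (xs : List A) → count (λ _ → false) xs ≡ 0
    count-false []       = refl
    count-false (x ∷ xs) = count-false xs

    count-cong : ∀ (p q : A → Bool) xs → (∀ {y} → y ∈ xs → p y ≡ q y) → count p xs ≡ count q xs
    count-cong p q []       _   = refl
    count-cong p q (x ∷ xs) p≗q =
      cong₂ (λ b r → indicator b + r) (p≗q (here refl)) (count-cong p q xs (p≗q ∘ there))

    count-+-cong : ∀ (p q r s : A → Bool) xs →
      (∀ {y} → y ∈ xs → indicator (p y) + indicator (q y) ≡ indicator (r y) + indicator (s y)) →
      count p xs + count q xs ≡ count r xs + count s xs
    count-+-cong p q r s []       _  = refl
    count-+-cong p q r s (x ∷ xs) eq = begin
      (indicator (p x) + count p xs) + (indicator (q x) + count q xs)
        ≡⟨ interchange (indicator (p x)) (count p xs) (indicator (q x)) (count q xs) ⟩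
      (indicator (p x) + indicator (q x)) + (count p xs + count q xs)
        ≡⟨ cong₂ _+_ (eq (here refl)) (count-+-cong p q r s xs (eq ∘ there)) ⟩
      (indicator (r x) + indicator (s x)) + (count r xs + count s xs)
        ≡⟨ interchange (indicator (r x)) (indicator (s x)) (count r xs) (count s xs) ⟩
      (indicator (r x) + count r xs) + (indicator (s x) + count s xs) ∎
      where open ≡-Reasoning

  pairCount : ℤ → ℤ → List ℤ → ℕ
  pairCount a b []       = 0
  pairCount a b (x ∷ xs) = count (λ y → (x ==ℤ a) ∧ (y ==ℤ b)) xs + pairCount a b xs

  pairCount-+ : ∀ {a b} w → a ≢ b →
    pairCount a b w + pairCount b a w ≡ count (_==ℤ a) w * count (_==ℤ b) w
  pairCount-+ []       _   = refl
  pairCount-+ {a} {b} (x ∷ xs) a≢b with x ==ℤ a in x==a | x ==ℤ b in x==b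
  ... | true  | true  = ⊥-elim (a≢b (trans (sym (==ℤ⇒≡ x==a)) (==ℤ⇒≡ x==b)))
  ... | true  | false rewrite count-false xs =
    trans (+-assoc (count (_==ℤ b) xs) _ _) (cong (count (_==ℤ b) xs ℕ.+_) (pairCount-+ xs a≢b))
  ... | false | true  rewrite count-false xs = begin
    pairCount a b xs + (count (_==ℤ a) xs + pairCount b a xs)
      ≡⟨ x∙yz≈y∙xz (pairCount a b xs) (count (_==ℤ a) xs) (pairCount b a xs) ⟩
    count (_==ℤ a) xs + (pairCount a b xs + pairCount b a xs)
      ≡⟨ cong (count (_==ℤ a) xs ℕ.+_) (pairCount-+ xs a≢b) ⟩
    count (_==ℤ a) xs + count (_==ℤ a) xs * count (_==ℤ b) xs
      ≡⟨ *-suc (count (_==ℤ a) xs) (count (_==ℤ b) xs) ⟨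
    count (_==ℤ a) xs * suc (count (_==ℤ b) xs) ∎
    where open ≡-Reasoning
  ... | false | false rewrite count-false xs = pairCount-+ xs a≢b

  differ-by-one : ∀ a b p q → a + p ≡ b + q → p + q ≡ 1 → a ≡ suc b ⊎ b ≡ suc a
  differ-by-one a b zero       q    a+0≡b+q refl =
    inj₁ (trans (sym (ℕP.+-identityʳ a)) (trans a+0≡b+q (ℕP.+-comm b 1)))
  differ-by-one a b (suc zero) zero a+1≡b   _    =
    inj₂ (trans (sym (ℕP.+-identityʳ b)) (trans (sym a+1≡b) (ℕP.+-comm a 1)))

open Counting

-- τ applies the transposition (n-1 n) to absolute values and keeps signs; k = n - 2.
module ValueSwap (k : ℕ) where
  open import Data.Integer using (-_)

  n : ℕ
  n = suc (suc k)

  τ : ℤ → ℤ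
  τ (+ i)    = + swapAdj (suc k) i
  τ -[1+ i ] = -[1+ swapAdj k i ]

  -n -[n-1] +n +[n-1] : ℤ
  -n     = -[1+ suc k ]
  -[n-1] = -[1+ k ]
  +n     = + n
  +[n-1] = + suc k

  τ-n : τ -n ≡ -[n-1]
  τ-n = cong -[1+_] (swapAdj-right k)

  τ-[n-1] : τ -[n-1] ≡ -n
  τ-[n-1] = cong -[1+_] (swapAdj-left k)

  ∣τ∣ : ∀ x → ∣ τ x ∣ ≡ swapAdj (suc k) ∣ x ∣
  ∣τ∣ (+ i)    = refl
  ∣τ∣ -[1+ i ] = refl

  τ-neg : ∀ x → τ (- x) ≡ - τ x
  τ-neg (+ zero)  = refl
  τ-neg (+ suc i) = refl
  τ-neg -[1+ i ]  = refl

  τ-==ℤ : ∀ x y → (τ x ==ℤ τ y) ≡ (x ==ℤ y)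
  τ-==ℤ (+ i)    (+ j)    = isYes≡isYes _ _ (swapAdj-≡ᵇ (suc k) i j)
  τ-==ℤ (+ i)    -[1+ j ] = refl
  τ-==ℤ -[1+ i ] (+ j)    = refl
  τ-==ℤ -[1+ i ] -[1+ j ] = isYes≡isYes _ _ (swapAdj-≡ᵇ k i j)

  τ-<ℤ : ∀ a b → ¬ IsPair -n -[n-1] a b → ¬ IsPair +[n-1] +n a b → (τ a <ℤ τ b) ≡ (a <ℤ b)
  τ-<ℤ (+ i)    (+ j)    _ ¬+ = isYes≡isYes _ _ (swapAdj-<ᵇ (suc k) i j (¬+ ∘ IsPair-+))
    where
    IsPair-+ : IsPair (suc k) n i j → IsPair +[n-1] +n (+ i) (+ j)
    IsPair-+ (inj₁ (i≡ , j≡)) = inj₁ (cong +_ i≡ , cong +_ j≡)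
    IsPair-+ (inj₂ (i≡ , j≡)) = inj₂ (cong +_ i≡ , cong +_ j≡)
  τ-<ℤ (+ i)    -[1+ j ] _ _  = refl
  τ-<ℤ -[1+ i ] (+ j)    _ _  = refl
  τ-<ℤ -[1+ i ] -[1+ j ] ¬- _ = isYes≡isYes _ _ (swapAdj-<ᵇ k j i (¬- ∘ IsPair-−))
    where
    IsPair-− : IsPair k (suc k) j i → IsPair -n -[n-1] -[1+ i ] -[1+ j ]
    IsPair-− (inj₁ (j≡ , i≡)) = inj₁ (cong -[1+_] i≡ , cong -[1+_] j≡)
    IsPair-− (inj₂ (j≡ , i≡)) = inj₂ (cong -[1+_] i≡ , cong -[1+_] j≡)

module WordSwap (k : ℕ) where
  open import Data.Nat using (_+_)
  open ValueSwap k

  cond5-pos : ∀ w → cond5 n w ≡ farApartᵐ (pos -n w) (pos -[n-1] w) ∧ inDᵇ (dd n w)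
  cond5-pos w with pos -n w | pos -[n-1] w
  ... | just i  | just j  = ∧-comm (inDᵇ (dd n w)) (farApartᵇ i j)
  ... | just i  | nothing = refl
  ... | nothing | just j  = refl
  ... | nothing | nothing = refl

  -n-precedes : List ℤ → Bool
  -n-precedes w = precedesᵐ (pos -n w) (pos -[n-1] w)

  ∣τ∣-≡ᵇ : ∀ x y → (∣ τ x ∣ ≡ᵇ ∣ τ y ∣) ≡ (∣ x ∣ ≡ᵇ ∣ y ∣)
  ∣τ∣-≡ᵇ x y rewrite ∣τ∣ x | ∣τ∣ y = swapAdj-≡ᵇ (suc k) ∣ x ∣ ∣ y ∣

  distinctAbs-τ : ∀ w → distinctAbs (map τ w) ≡ distinctAbs w
  distinctAbs-τ []       = refl
  distinctAbs-τ (x ∷ xs) = cong₂ (λ a b → not a ∧ b) (any-τ xs) (distinctAbs-τ xs)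
    where
    any-τ : ∀ ys → any (λ y → ∣ τ x ∣ ≡ᵇ ∣ y ∣) (map τ ys) ≡ any (λ y → ∣ x ∣ ≡ᵇ ∣ y ∣) ys
    any-τ []       = refl
    any-τ (y ∷ ys) = cong₂ _∨_ (∣τ∣-≡ᵇ x y) (any-τ ys)

  τ-<0 : ∀ x → (τ x <ℤ (+ 0)) ≡ (x <ℤ (+ 0))
  τ-<0 x = τ-<ℤ x (+ 0) (λ { (inj₁ (_ , ())) ; (inj₂ (_ , ())) })
                        (λ { (inj₁ (_ , ())) ; (inj₂ (_ , ())) })

  negs-τ : ∀ w → negs (map τ w) ≡ negs w
  negs-τ []       = refl
  negs-τ (x ∷ xs) = cong₂ (λ b r → indicator b + r) (τ-<0 x) (negs-τ xs)

  inDᵇ-τ : ∀ w → inDᵇ (map τ w) ≡ inDᵇ w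
  inDᵇ-τ w = cong evenᵇ (negs-τ w)

  dd-τ : ∀ w → dd n (map τ w) ≡ map τ (dd n w)
  dd-τ = filter-map kept τ kept-τ
    where
    kept : ℤ → Bool
    kept x = not ((∣ x ∣ ≡ᵇ n) ∨ (∣ x ∣ ≡ᵇ n ∸ 1))
    ≡ᵇ-swapped : ∀ i c {c′} → swapAdj (suc k) c ≡ c′ → (swapAdj (suc k) i ≡ᵇ c′) ≡ (i ≡ᵇ c)
    ≡ᵇ-swapped i c refl = swapAdj-≡ᵇ (suc k) i c
    kept-τ : ∀ x → kept (τ x) ≡ kept x
    kept-τ x rewrite ∣τ∣ x = cong not (trans
      (cong₂ _∨_ (≡ᵇ-swapped ∣ x ∣ (suc k) (swapAdj-left (suc k)))
                 (≡ᵇ-swapped ∣ x ∣ n (swapAdj-right (suc k))))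
      (∨-comm (∣ x ∣ ≡ᵇ suc k) (∣ x ∣ ≡ᵇ n)))

  pos-τ : ∀ v w → pos (τ v) (map τ w) ≡ pos v w
  pos-τ v []       = refl
  pos-τ v (x ∷ xs) rewrite τ-==ℤ x v with x ==ℤ v
  ... | true  = refl
  ... | false rewrite pos-τ v xs with pos v xs
  ...   | just i  = refl
  ...   | nothing = refl

  pos-n-τ : ∀ w → pos -n (map τ w) ≡ pos -[n-1] w
  pos-n-τ w = trans (cong (λ v → pos v (map τ w)) (sym τ-[n-1])) (pos-τ -[n-1] w)

  pos-[n-1]-τ : ∀ w → pos -[n-1] (map τ w) ≡ pos -n w
  pos-[n-1]-τ w = trans (cong (λ v → pos v (map τ w)) (sym τ-n)) (pos-τ -n w)

  cond5-τ : ∀ w → cond5 n (map τ w) ≡ cond5 n w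
  cond5-τ w = begin
    cond5 n (map τ w)
      ≡⟨ cond5-pos (map τ w) ⟩
    farApartᵐ (pos -n (map τ w)) (pos -[n-1] (map τ w)) ∧ inDᵇ (dd n (map τ w))
      ≡⟨ cong₂ (λ a b → farApartᵐ a b ∧ inDᵇ (dd n (map τ w))) (pos-n-τ w) (pos-[n-1]-τ w) ⟩
    farApartᵐ (pos -[n-1] w) (pos -n w) ∧ inDᵇ (dd n (map τ w))
      ≡⟨ cong₂ _∧_ (farApartᵐ-sym (pos -[n-1] w) (pos -n w))
                   (trans (cong inDᵇ (dd-τ w)) (inDᵇ-τ (dd n w))) ⟩
    farApartᵐ (pos -n w) (pos -[n-1] w) ∧ inDᵇ (dd n w)
      ≡⟨ cond5-pos w ⟨
    cond5 n w ∎
    where open ≡-Reasoning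

  cond5⇒farApartᵐ : ∀ w → cond5 n w ≡ true → farApartᵐ (pos -n w) (pos -[n-1] w) ≡ true
  cond5⇒farApartᵐ w c5 = ∧≡true⇒ˡ _ _ (trans (sym (cond5-pos w)) c5)

  -n-precedes-τ : ∀ w → cond5 n w ≡ true → -n-precedes (map τ w) ≡ not (-n-precedes w)
  -n-precedes-τ w c5 = trans (cong₂ precedesᵐ (pos-n-τ w) (pos-[n-1]-τ w))
    (precedesᵐ-flip (pos -n w) (pos -[n-1] w) (cond5⇒farApartᵐ w c5))

  cond5⇒∈ : ∀ w → cond5 n w ≡ true → -n ∈ w × -[n-1] ∈ w
  cond5⇒∈ w c5 with farApartᵐ⇒just _ _ (cond5⇒farApartᵐ w c5)
  ... | _ , _ , pos-n , pos-[n-1] = pos⇒∈ -n w pos-n , pos⇒∈ -[n-1] w pos-[n-1]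

  cond5⇒∉ : ∀ w → distinctAbs w ≡ true → cond5 n w ≡ true → +[n-1] ∉ w × +n ∉ w
  cond5⇒∉ w distinct c5 =
    (λ +∈ → case distinctAbs-∈ w distinct +∈ (proj₂ (cond5⇒∈ w c5)) refl of λ ()) ,
    (λ +∈ → case distinctAbs-∈ w distinct +∈ (proj₁ (cond5⇒∈ w c5)) refl of λ ())

module SwapStatistics (k : ℕ) where
  open import Data.Nat using (_+_; _*_)
  open import Data.Integer using (-_)
  open import Data.Nat.Tactic.RingSolver using (solve-∀)
  open ValueSwap k
  open WordSwap k

  -n<-[n-1] : -n ℤ.< -[n-1]
  -n<-[n-1] = ℤ.-<- (ℕP.n<1+n k)

  -n≢-[n-1] : -n ≢ -[n-1]
  -n≢-[n-1] = ℤP.<⇒≢ -n<-[n-1]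

  <ℤ-irrefl : ∀ x → x <ℤ x ≡ false
  <ℤ-irrefl x = ≮⇒<ℤ (ℤP.<-irrefl refl)

  -n<ℤ-[n-1] : -n <ℤ -[n-1] ≡ true
  -n<ℤ-[n-1] = <⇒<ℤ -n<-[n-1]

  -[n-1]≮ℤ-n : -[n-1] <ℤ -n ≡ false
  -[n-1]≮ℤ-n = ≮⇒<ℤ (ℤP.<-asym -n<-[n-1])

  τ-[n-1]<ℤτ-n : τ -[n-1] <ℤ τ -n ≡ true
  τ-[n-1]<ℤτ-n = trans (cong₂ _<ℤ_ τ-[n-1] τ-n) -n<ℤ-[n-1]

  τ-n≮ℤτ-[n-1] : τ -n <ℤ τ -[n-1] ≡ false
  τ-n≮ℤτ-[n-1] = trans (cong₂ _<ℤ_ τ-n τ-[n-1]) -[n-1]≮ℤ-n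

  -- τ reverses only the comparison between -n and -(n-1); the indicators record that pair.
  τ-<ℤ-pairs : ∀ x y → x ≢ +[n-1] → x ≢ +n →
    indicator (τ y <ℤ τ x) + indicator ((x ==ℤ -[n-1]) ∧ (y ==ℤ -n))
      ≡ indicator (y <ℤ x) + indicator ((x ==ℤ -n) ∧ (y ==ℤ -[n-1]))
  τ-<ℤ-pairs x y x≢+ x≢+′ with x ==ℤ -n in x==a | x ==ℤ -[n-1] in x==b
  ... | true  | true  = ⊥-elim (-n≢-[n-1] (trans (sym (==ℤ⇒≡ x==a)) (==ℤ⇒≡ x==b)))
  ... | false | false = cong (λ b → indicator b + 0)
    (τ-<ℤ y x (¬IsPair-right (==ℤ-false⇒≢ x==a) (==ℤ-false⇒≢ x==b)) (¬IsPair-right x≢+ x≢+′))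
  ... | true  | false with refl ← ==ℤ⇒≡ x==a with y ==ℤ -n in y==a | y ==ℤ -[n-1] in y==b
  ...   | true  | true  = ⊥-elim (-n≢-[n-1] (trans (sym (==ℤ⇒≡ y==a)) (==ℤ⇒≡ y==b)))
  ...   | false | true  with refl ← ==ℤ⇒≡ y==b =
    trans (cong (λ b → indicator b + 0) τ-[n-1]<ℤτ-n) (cong (λ b → indicator b + 1) (sym -[n-1]≮ℤ-n))
  ...   | true  | false with refl ← ==ℤ⇒≡ y==a =
    cong (λ b → b + 0) (trans (cong indicator (<ℤ-irrefl (τ -n))) (cong indicator (sym (<ℤ-irrefl -n))))
  ...   | false | false = cong (λ b → indicator b + 0)
    (τ-<ℤ y -n (¬IsPair-left (==ℤ-false⇒≢ y==a) (==ℤ-false⇒≢ y==b)) (¬IsPair-right x≢+ x≢+′))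
  τ-<ℤ-pairs x y x≢+ x≢+′ | false | true with refl ← ==ℤ⇒≡ x==b
    with y ==ℤ -n in y==a | y ==ℤ -[n-1] in y==b
  ...   | true  | true  = ⊥-elim (-n≢-[n-1] (trans (sym (==ℤ⇒≡ y==a)) (==ℤ⇒≡ y==b)))
  ...   | true  | false with refl ← ==ℤ⇒≡ y==a =
    trans (cong (λ b → indicator b + 1) τ-n≮ℤτ-[n-1]) (cong (λ b → indicator b + 0) (sym -n<ℤ-[n-1]))
  ...   | false | true  with refl ← ==ℤ⇒≡ y==b =
    cong (λ b → b + 0)
      (trans (cong indicator (<ℤ-irrefl (τ -[n-1]))) (cong indicator (sym (<ℤ-irrefl -[n-1]))))
  ...   | false | false = cong (λ b → indicator b + 0)
    (τ-<ℤ y -[n-1] (¬IsPair-left (==ℤ-false⇒≢ y==a) (==ℤ-false⇒≢ y==b)) (¬IsPair-right x≢+ x≢+′))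

  τ-<ℤ-neg : ∀ x y → x ≢ +[n-1] → x ≢ +n → y ≢ +[n-1] → y ≢ +n →
    (τ y <ℤ (- (τ x))) ≡ (y <ℤ (- x))
  τ-<ℤ-neg x y x≢+ x≢+′ y≢+ y≢+′ = trans (cong (τ y <ℤ_) (sym (τ-neg x)))
    (τ-<ℤ y (- x) (¬IsPair-right (x≢+′ ∘ ℤP.neg-injective) (x≢+ ∘ ℤP.neg-injective))
                  (¬IsPair-left y≢+ y≢+′))

  invD-τ : ∀ w → +[n-1] ∉ w → +n ∉ w →
    invD (map τ w) + pairCount -[n-1] -n w ≡ invD w + pairCount -n -[n-1] w
  invD-τ []       _   _    = refl
  invD-τ (x ∷ xs) +∉ +′∉ = begin
    (below′ + belowNeg′ + invD (map τ xs)) + (pairs′ + pairCount -[n-1] -n xs)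
      ≡⟨ rearrange below′ belowNeg′ (invD (map τ xs)) pairs′ (pairCount -[n-1] -n xs) ⟩
    (below′ + pairs′) + belowNeg′ + (invD (map τ xs) + pairCount -[n-1] -n xs)
      ≡⟨ cong₂ _+_ (cong₂ _+_ below-pairs belowNeg-τ)
                   (invD-τ xs (proj₂ (∉-∷ +∉)) (proj₂ (∉-∷ +′∉))) ⟩
    (below + pairs) + belowNeg + (invD xs + pairCount -n -[n-1] xs)
      ≡⟨ rearrange below belowNeg (invD xs) pairs (pairCount -n -[n-1] xs) ⟨
    (below + belowNeg + invD xs) + (pairs + pairCount -n -[n-1] xs) ∎
    where
    open ≡-Reasoning
    rearrange : ∀ a b c d e → (a + b + c) + (d + e) ≡ (a + d) + b + (c + e)
    rearrange = solve-∀
    below′ belowNeg′ pairs′ below belowNeg pairs : ℕ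
    below′    = count (_<ℤ τ x) (map τ xs)
    belowNeg′ = count (_<ℤ (- (τ x))) (map τ xs)
    pairs′    = count (λ y → (x ==ℤ -[n-1]) ∧ (y ==ℤ -n)) xs
    below     = count (_<ℤ x) xs
    belowNeg  = count (_<ℤ (- x)) xs
    pairs     = count (λ y → (x ==ℤ -n) ∧ (y ==ℤ -[n-1])) xs
    x≢+ : x ≢ +[n-1]
    x≢+ = ≢-sym (proj₁ (∉-∷ +∉))
    x≢+′ : x ≢ +n
    x≢+′ = ≢-sym (proj₁ (∉-∷ +′∉))
    below-pairs : below′ + pairs′ ≡ below + pairs
    below-pairs = trans (cong (_+ pairs′) (count-map (_<ℤ τ x) τ xs))
      (count-+-cong _ _ _ _ xs λ {y} _ → τ-<ℤ-pairs x y x≢+ x≢+′)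
    belowNeg-τ : belowNeg′ ≡ belowNeg
    belowNeg-τ = trans (count-map (_<ℤ (- (τ x))) τ xs) (count-cong _ _ xs λ {y} y∈ →
      τ-<ℤ-neg x y x≢+ x≢+′ (∈∧∉⇒≢ y∈ (proj₂ (∉-∷ +∉))) (∈∧∉⇒≢ y∈ (proj₂ (∉-∷ +′∉))))

  desB-τ : ∀ w → distinctAbs w ≡ true → cond5 n w ≡ true → desB (map τ w) ≡ desB w
  desB-τ w distinct c5 = desFrom-map τ (+ 0) w (Linked.zipWith τ-order
    ( separated (+ 0) w distinct -n≢-[n-1] (λ ()) (λ ()) (cond5⇒farApartᵐ w c5)
    , separated-∉ (+ 0) w λ { (here ()) ; (there +∈) → proj₁ (cond5⇒∉ w distinct c5) +∈ }))
    where
    τ-order : ∀ {a b} → ¬ IsPair -n -[n-1] a b × ¬ IsPair +[n-1] +n a b → (τ b <ℤ τ a) ≡ (b <ℤ a)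
    τ-order (¬- , ¬+) = τ-<ℤ _ _ (¬- ∘ IsPair-flip) (¬+ ∘ IsPair-flip)

  ascB-τ : ∀ w → distinctAbs w ≡ true → cond5 n w ≡ true → ascB (map τ w) ≡ ascB w
  ascB-τ w distinct c5 = cong₂ _∸_ (length-map τ w) (desB-τ w distinct c5)

  invD-τ-differ-by-one : ∀ w → distinctAbs w ≡ true → cond5 n w ≡ true →
    invD (map τ w) ≡ suc (invD w) ⊎ invD w ≡ suc (invD (map τ w))
  invD-τ-differ-by-one w distinct c5 = differ-by-one (invD (map τ w)) (invD w) _ _
    (invD-τ w (proj₁ (cond5⇒∉ w distinct c5)) (proj₂ (cond5⇒∉ w distinct c5)))
    (trans (pairCount-+ w (-n≢-[n-1] ∘ sym))
      (cong₂ _*_ (count-==ℤ-∈ w distinct (proj₂ (cond5⇒∈ w c5)))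
                 (count-==ℤ-∈ w distinct (proj₁ (cond5⇒∈ w c5)))))

-- Sums in a commutative ring

upTo-2+ : ∀ c → upTo (suc (suc c)) ≡ upTo c ++ c ∷ suc c ∷ []
upTo-2+ c = trans (sym (upTo-∷ʳ (suc c)))
  (trans (cong (_∷ʳ suc c) (sym (upTo-∷ʳ c))) (++-assoc (upTo c) (c ∷ []) (suc c ∷ [])))

module Sums {c ℓ : Level} (R : CommutativeRing c ℓ) where
  open CommutativeRing R renaming (refl to ≈-refl; sym to ≈-sym; trans to ≈-trans)
  open RingProperties ring using (-‿+-comm; -0#≈0#)
  open import Algebra.Properties.CommutativeSemigroup +-commutativeSemigroup using (interchange; x∙yz≈y∙xz)
  open import Relation.Binary.Reasoning.Setoid setoid

  private variable
    X Y : Set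

  sumOver : (X → Carrier) → List X → Carrier
  sumOver g = foldr (λ x acc → g x + acc) 0#

  sumOver-cong : {g h : X → Carrier} → (∀ w → g w ≈ h w) → ∀ L → sumOver g L ≈ sumOver h L
  sumOver-cong g≈h []       = ≈-refl
  sumOver-cong g≈h (x ∷ xs) = +-cong (g≈h x) (sumOver-cong g≈h xs)

  sumOver-++ : (g : X → Carrier) → ∀ L M → sumOver g (L ++ M) ≈ sumOver g L + sumOver g M
  sumOver-++ g []       M = ≈-sym (+-identityˡ _)
  sumOver-++ g (x ∷ xs) M = ≈-trans (+-congˡ (sumOver-++ g xs M)) (≈-sym (+-assoc _ _ _))

  sumOver-map : (g : Y → Carrier) (f : X → Y) → ∀ L → sumOver g (map f L) ≡ sumOver (g ∘ f) L
  sumOver-map g f []       = refl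
  sumOver-map g f (x ∷ xs) = cong (_+_ (g (f x))) (sumOver-map g f xs)

  sumOver-concatMap : (g : Y → Carrier) (f : X → List Y) → ∀ L →
    sumOver g (concatMap f L) ≈ sumOver (sumOver g ∘ f) L
  sumOver-concatMap g f []       = ≈-refl
  sumOver-concatMap g f (x ∷ xs) =
    ≈-trans (sumOver-++ g (f x) (concatMap f xs)) (+-congˡ (sumOver-concatMap g f xs))

  sumOver-+ : (g h : X → Carrier) → ∀ L → sumOver (λ w → g w + h w) L ≈ sumOver g L + sumOver h L
  sumOver-+ g h []       = ≈-sym (+-identityˡ _)
  sumOver-+ g h (x ∷ xs) = begin
    (g x + h x) + sumOver (λ w → g w + h w) xs ≈⟨ +-congˡ (sumOver-+ g h xs) ⟩
    (g x + h x) + (sumOver g xs + sumOver h xs) ≈⟨ interchange (g x) (h x) (sumOver g xs) (sumOver h xs) ⟩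
    (g x + sumOver g xs) + (h x + sumOver h xs) ∎

  sumOver-neg : (g : X → Carrier) → ∀ L → sumOver (λ w → - g w) L ≈ - sumOver g L
  sumOver-neg g []       = ≈-sym -0#≈0#
  sumOver-neg g (x ∷ xs) = ≈-trans (+-congˡ (sumOver-neg g xs)) (-‿+-comm (g x) (sumOver g xs))

  sumOver-filter : (p : X → Bool) (g : X → Carrier) → ∀ L →
    sumOver g (filter (T? ∘ p) L) ≈ sumOver (λ w → if p w then g w else 0#) L
  sumOver-filter p g []       = ≈-refl
  sumOver-filter p g (x ∷ xs) with p x
  ... | true  = +-congˡ (sumOver-filter p g xs)
  ... | false = ≈-trans (sumOver-filter p g xs) (≈-sym (+-identityˡ _))

  sumOver-cong-∈ : {g h : X → Carrier} → ∀ L → (∀ {x} → x ∈ L → g x ≈ h x) →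
    sumOver g L ≈ sumOver h L
  sumOver-cong-∈ []       _   = ≈-refl
  sumOver-cong-∈ (x ∷ xs) g≈h = +-cong (g≈h (here refl)) (sumOver-cong-∈ xs (g≈h ∘ there))

  sumOver-swapAdj : ∀ c (F : ℕ → Carrier) →
    sumOver (F ∘ swapAdj c) (upTo (suc (suc c))) ≈ sumOver F (upTo (suc (suc c)))
  sumOver-swapAdj c F = subst (λ L → sumOver (F ∘ swapAdj c) L ≈ sumOver F L) (sym (upTo-2+ c)) (begin
    sumOver (F ∘ swapAdj c) (upTo c ++ c ∷ suc c ∷ [])
      ≈⟨ sumOver-++ (F ∘ swapAdj c) (upTo c) _ ⟩
    sumOver (F ∘ swapAdj c) (upTo c) + (F (swapAdj c c) + (F (swapAdj c (suc c)) + 0#))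
      ≈⟨ +-cong (sumOver-cong-∈ (upTo c) λ i∈ → reflexive (cong F (swapAdj-below c _ (∈-upTo⁻ i∈))))
                (reflexive (cong₂ (λ a b → F a + (F b + 0#)) (swapAdj-left c) (swapAdj-right c))) ⟩
    sumOver F (upTo c) + (F (suc c) + (F c + 0#))
      ≈⟨ +-congˡ (x∙yz≈y∙xz (F (suc c)) (F c) 0#) ⟩
    sumOver F (upTo c) + (F c + (F (suc c) + 0#))
      ≈⟨ sumOver-++ F (upTo c) _ ⟨
    sumOver F (upTo c ++ c ∷ suc c ∷ []) ∎)

  sumOver-words-map : ∀ (f : ℤ → ℤ) m → (∀ H → sumOver (H ∘ f) (letters m) ≈ sumOver H (letters m)) →
    ∀ j (g : List ℤ → Carrier) → sumOver (g ∘ map f) (words j m) ≈ sumOver g (words j m)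
  sumOver-words-map f m f-letters zero    g = ≈-refl
  sumOver-words-map f m f-letters (suc j) g = begin
    sumOver (g ∘ map f) (concatMap (λ x → map (x ∷_) (words j m)) (letters m))
      ≈⟨ sumOver-concatMap (g ∘ map f) _ (letters m) ⟩
    sumOver (λ x → sumOver (g ∘ map f) (map (x ∷_) (words j m))) (letters m)
      ≈⟨ sumOver-cong (λ x → ≈-trans (reflexive (sumOver-map (g ∘ map f) (x ∷_) (words j m)))
                                     (sumOver-words-map f m f-letters j (g ∘ (f x ∷_)))) (letters m) ⟩
    sumOver (λ x → sumOver (g ∘ (f x ∷_)) (words j m)) (letters m)
      ≈⟨ f-letters (λ y → sumOver (g ∘ (y ∷_)) (words j m)) ⟩
    sumOver (λ x → sumOver (g ∘ (x ∷_)) (words j m)) (letters m)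
      ≈⟨ sumOver-cong (λ x → reflexive (sumOver-map g (x ∷_) (words j m))) (letters m) ⟨
    sumOver (λ x → sumOver g (map (x ∷_) (words j m))) (letters m)
      ≈⟨ sumOver-concatMap g _ (letters m) ⟨
    sumOver g (concatMap (λ x → map (x ∷_) (words j m)) (letters m)) ∎

  -- Matching the terms with b against those without b (rather than each term against
  -- its own image) avoids dividing by 2.
  sumOver-sign-reversing : (f : X → X) (L : List X) → (∀ g → sumOver (g ∘ f) L ≈ sumOver g L) →
    (S b : X → Bool) (G : X → Carrier) → (∀ w → S (f w) ≡ S w) →
    (∀ w → S w ≡ true → b (f w) ≡ not (b w)) → (∀ w → S w ≡ true → G (f w) ≈ - G w) →
    sumOver (λ w → if S w then G w else 0#) L ≈ 0#
  sumOver-sign-reversing {X} f L f-invariant S b G S∘f b∘f G∘f = begin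
    sumOver H L                               ≈⟨ sumOver-cong H-split L ⟩
    sumOver (λ w → Hᵇ w + H¬ᵇ w) L            ≈⟨ sumOver-+ Hᵇ H¬ᵇ L ⟩
    sumOver Hᵇ L + sumOver H¬ᵇ L              ≈⟨ +-congˡ (f-invariant H¬ᵇ) ⟨
    sumOver Hᵇ L + sumOver (H¬ᵇ ∘ f) L        ≈⟨ +-congˡ (sumOver-cong H¬ᵇ∘f L) ⟩
    sumOver Hᵇ L + sumOver (λ w → - Hᵇ w) L   ≈⟨ +-congˡ (sumOver-neg Hᵇ L) ⟩
    sumOver Hᵇ L + - sumOver Hᵇ L             ≈⟨ -‿inverseʳ _ ⟩
    0#                                        ∎
    where
    H Hᵇ H¬ᵇ : X → Carrier
    H   w = if S w then G w else 0#
    Hᵇ  w = if b w then H w else 0#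
    H¬ᵇ w = if b w then 0# else H w

    H-split : ∀ w → H w ≈ Hᵇ w + H¬ᵇ w
    H-split w with b w
    ... | true  = ≈-sym (+-identityʳ _)
    ... | false = ≈-sym (+-identityˡ _)

    H¬ᵇ∘f : ∀ w → H¬ᵇ (f w) ≈ - Hᵇ w
    H¬ᵇ∘f w with S w in Sw
    ... | false rewrite S∘f w | Sw with b (f w) | b w
    ...   | true  | true  = ≈-sym -0#≈0#
    ...   | true  | false = ≈-sym -0#≈0#
    ...   | false | true  = ≈-sym -0#≈0#
    ...   | false | false = ≈-sym -0#≈0#
    H¬ᵇ∘f w | true rewrite S∘f w | Sw | b∘f w Sw with b w
    ... | true  = G∘f w Sw
    ... | false = ≈-sym -0#≈0#

-- The sign-reversing involution

module SignReversal {c ℓ : Level} (R : CommutativeRing c ℓ) (k : ℕ) (s t : CommutativeRing.Carrier R) where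
  open CommutativeRing R renaming (refl to ≈-refl; sym to ≈-sym; trans to ≈-trans)
  open RingProperties ring using (-‿distribˡ-*; -‿involutive; -1*x≈-x)
  open import Relation.Binary.Reasoning.Setoid setoid
  open Sums R
  open ValueSwap k
  open WordSwap k
  open SwapStatistics k

  weight : List ℤ → Carrier
  weight w = signPow R (invD w) * pow R s (ascB w) * pow R t (desB w)

  inD5ᵇ : List ℤ → Bool
  inD5ᵇ w = distinctAbs w ∧ (inDᵇ w ∧ cond5 n w)

  genSum-D5 : genSum R s t (D5 n) ≈ sumOver (λ w → if inD5ᵇ w then weight w else 0#) (words n n)
  genSum-D5 = begin
    sumOver weight (D5 n)
      ≈⟨ sumOver-filter (cond5 n) weight (D n) ⟩
    sumOver (λ w → if cond5 n w then weight w else 0#) (D n)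
      ≈⟨ sumOver-filter inDᵇ _ (B n) ⟩
    sumOver (λ w → if inDᵇ w then (if cond5 n w then weight w else 0#) else 0#) (B n)
      ≈⟨ sumOver-filter distinctAbs _ (words n n) ⟩
    sumOver (λ w → if distinctAbs w
                     then (if inDᵇ w then (if cond5 n w then weight w else 0#) else 0#)
                     else 0#) (words n n)
      ≈⟨ sumOver-cong (λ w → reflexive (trans (if-∧ (distinctAbs w))
                                 (cong (λ z → if distinctAbs w then z else 0#) (if-∧ (inDᵇ w))))) (words n n) ⟨
    sumOver (λ w → if inD5ᵇ w then weight w else 0#) (words n n) ∎

  inD5ᵇ-τ : ∀ w → inD5ᵇ (map τ w) ≡ inD5ᵇ w
  inD5ᵇ-τ w = cong₂ _∧_ (distinctAbs-τ w) (cong₂ _∧_ (inDᵇ-τ w) (cond5-τ w))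

  sumOver-letters-τ : ∀ H → sumOver (H ∘ τ) (letters n) ≈ sumOver H (letters n)
  sumOver-letters-τ H = begin
    sumOver (H ∘ τ) (map (λ i → + suc i) (upTo n) ++ map (λ i → -[1+ i ]) (upTo n))
      ≈⟨ sumOver-++ (H ∘ τ) (map (λ i → + suc i) (upTo n)) _ ⟩
    sumOver (H ∘ τ) (map (λ i → + suc i) (upTo n)) + sumOver (H ∘ τ) (map (λ i → -[1+ i ]) (upTo n))
      ≈⟨ reflexive (cong₂ _+_ (sumOver-map (H ∘ τ) _ (upTo n)) (sumOver-map (H ∘ τ) _ (upTo n))) ⟩
    sumOver (λ i → H (+ suc (swapAdj k i))) (upTo n) + sumOver (λ i → H -[1+ swapAdj k i ]) (upTo n)
      ≈⟨ +-cong (sumOver-swapAdj k (λ i → H (+ suc i))) (sumOver-swapAdj k (λ i → H -[1+ i ])) ⟩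
    sumOver (λ i → H (+ suc i)) (upTo n) + sumOver (λ i → H -[1+ i ]) (upTo n)
      ≈⟨ reflexive (cong₂ _+_ (sumOver-map H _ (upTo n)) (sumOver-map H _ (upTo n))) ⟨
    sumOver H (map (λ i → + suc i) (upTo n)) + sumOver H (map (λ i → -[1+ i ]) (upTo n))
      ≈⟨ sumOver-++ H (map (λ i → + suc i) (upTo n)) _ ⟨
    sumOver H (letters n) ∎

  signPow-suc : ∀ a → signPow R (suc a) ≈ - signPow R a
  signPow-suc a = -1*x≈-x (signPow R a)

  weight-τ : ∀ w → distinctAbs w ≡ true → cond5 n w ≡ true → weight (map τ w) ≈ - weight w
  weight-τ w distinct c5 = begin
    signPow R (invD (map τ w)) * pow R s (ascB (map τ w)) * pow R t (desB (map τ w))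
      ≈⟨ *-cong (*-cong signPow-τ (reflexive (cong (pow R s) (ascB-τ w distinct c5))))
                (reflexive (cong (pow R t) (desB-τ w distinct c5))) ⟩
    (- signPow R (invD w)) * pow R s (ascB w) * pow R t (desB w)
      ≈⟨ *-congʳ (-‿distribˡ-* _ _) ⟨
    (- (signPow R (invD w) * pow R s (ascB w))) * pow R t (desB w)
      ≈⟨ -‿distribˡ-* _ _ ⟨
    - weight w ∎
    where
    signPow-τ : signPow R (invD (map τ w)) ≈ - signPow R (invD w)
    signPow-τ with invD-τ-differ-by-one w distinct c5
    ... | inj₁ eq = ≈-trans (reflexive (cong (signPow R) eq)) (signPow-suc (invD w))
    ... | inj₂ eq = ≈-sym (≈-trans
      (-‿cong (≈-trans (reflexive (cong (signPow R) eq)) (signPow-suc (invD (map τ w)))))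
      (-‿involutive _))

  genSum-D5≈0 : genSum R s t (D5 n) ≈ 0#
  genSum-D5≈0 = ≈-trans genSum-D5 (sumOver-sign-reversing (map τ) (words n n)
    (sumOver-words-map τ n sumOver-letters-τ n) inD5ᵇ -n-precedes weight inD5ᵇ-τ
    (λ w in5 → -n-precedes-τ w (cond5-of w in5))
    (λ w in5 → weight-τ w (∧≡true⇒ˡ (distinctAbs w) _ in5) (cond5-of w in5)))
    where
    cond5-of : ∀ w → inD5ᵇ w ≡ true → cond5 n w ≡ true
    cond5-of w in5 = ∧≡true⇒ʳ (inDᵇ w) _ (∧≡true⇒ʳ (distinctAbs w) _ in5)

lemma5p8 : {c ℓ : Level} (R : CommutativeRing c ℓ) (n : ℕ) → 3 ≤ n →
    (s t : CommutativeRing.Carrier R) →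
    CommutativeRing._≈_ R (genSum R s t (D5 n)) (CommutativeRing.0# R)
lemma5p8 R (suc (suc (suc j))) (s≤s (s≤s (s≤s _))) s t = SignReversal.genSum-D5≈0 R (suc j) s t
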